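{- Let $(\sigma)$ and $(\tau)$ be two $(n-2)$-loops in $\mathcal{T}_n$ based at the same triangulation $T_0$ that are homotopic (i.e. $(\sigma)\simeq_A(\tau)$). Then $(\sigma)$ can be transformed into $(\tau)$ by a finite sequence of the following three operations (and their inverses): stretch, insert and switch.
   Context: Let $P_{n+3}$ be a convex $(n+3)$-gon. $\mathcal{T}_n$ is the simplicial complex on the diagonals of $P_{n+3}$ whose simplices are sets of pairwise non-crossing diagonals; maximal simplices are triangulations. Two triangulations are $(n-2)$-near if they are equal or differ by a single diagonal flip. The flip graph $\Gamma$ has triangulations as nodes and single flips as edges; it is triangle-free. An $(n-2)$-loop based at $T_0$ is a sequence $T_0,T_1,\dots,T_k=T_0$ with consecutive terms $(n-2)$-near. The equivalence $\simeq_A$ is generated by (1) repeating a term of a loop, and (2) declaring two loops of the same length equivalent if there is a grid between them: a finite sequence of loops of that length based at $T_0$, from one to the other, with the $i$-th terms of consecutive loops $(n-2)$-near for every $i$. (Equivalently, loops are homotopic iff the corresponding closed walks are homotopic in the 2-complex obtained from $\Gamma$ by attaching 2-cells along all 3- and 4-cycles.) The operations on a loop $T_0,\dots,T_k$: stretch: repeat some term $T_i$ (replace $T_i$ by $T_i,T_i$); insert: between two consecutive equal terms $T_i=T_{i+1}$ insert a triangulation $T_j$ differing from $T_i$ by one flip; switch: replace a term $T_i$ by a triangulation $T_j$ such that $T_{i-1},T_i,T_{i+1},T_j$ are distinct and form a 4-cycle in $\Gamma$ arising from a geodesic 4-cycle (two flips in two non-overlapping quadrilaterals), i.e. replace the path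 $T_{i-1},T_i,T_{i+1}$ by $T_{i-1},T_j,T_{i+1}$. -}

module Defs where

open import Data.Nat using (ℕ; zero; suc; _+_; _<_; _≤_)
open import Data.Fin using (Fin; toℕ)
open import Data.Bool using (Bool; true; false)
open import Data.Vec using (Vec; lookup)
open import Data.List using (List; []; _∷_; _++_; _∷ʳ_)
open import Data.List.Relation.Unary.All using (All)
open import Data.List.Relation.Unary.Linked using (Linked)
open import Data.List.Relation.Binary.Pointwise using (Pointwise)
open import Data.Product using (Σ; ∃; ∃-syntax; _×_; _,_)
open import Data.Sum using (_⊎_)
open import Relation.Nullary using (¬_)
open import Relation.Binary.PropositionalEquality using (_≡_; _≢_)
open import Relation.Binary.Construct.Closure.Equivalence using (EqClosure)

-- The convex polygon P_{n+3} has vertices 0,1,…,n+2 (Fin (n + 3)) in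
-- cyclic order.  A diagonal is recorded as an ordered pair (i , j) with
-- i < j, j ≥ i + 2, and (i , j) ≠ (0 , n+2) (the latter is a side).

Vert : ℕ → Set
Vert n = Fin (n + 3)

IsDiagonal : (n : ℕ) → Vert n → Vert n → Set
IsDiagonal n i j = (toℕ i + 2 ≤ toℕ j) × ¬ ((toℕ i ≡ 0) × (toℕ j ≡ n + 2))

Crosses : {n : ℕ} → Vert n → Vert n → Vert n → Vert n → Set
Crosses i j k l =
    (toℕ i < toℕ k × toℕ k < toℕ j × toℕ j < toℕ l)
  ⊎ (toℕ k < toℕ i × toℕ i < toℕ l × toℕ l < toℕ j)

-- A set of diagonals, encoded as a Boolean incidence matrix:
-- (i , j) belongs to S iff entry (i , j) is true.  Using a concrete
-- matrix makes equality of sets of diagonals coincide with _≡_.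
DiagSet : ℕ → Set
DiagSet n = Vec (Vec Bool (n + 3)) (n + 3)

_∋[_,_] : {n : ℕ} → DiagSet n → Vert n → Vert n → Set
S ∋[ i , j ] = lookup (lookup S i) j ≡ true

IsSimplex : (n : ℕ) → DiagSet n → Set
IsSimplex n S =
    (∀ i j → S ∋[ i , j ] → IsDiagonal n i j)
  × (∀ i j k l → S ∋[ i , j ] → S ∋[ k , l ] → ¬ Crosses i j k l)

IsTriangulation : (n : ℕ) → DiagSet n → Set
IsTriangulation n S =
    IsSimplex n S
  × (∀ i j → IsDiagonal n i j → ¬ (S ∋[ i , j ]) →
       ∃[ k ] ∃[ l ] (S ∋[ k , l ] × Crosses i j k l))

FlipVia : {n : ℕ} → DiagSet n → DiagSet n →
          Vert n → Vert n → Vert n → Vert n → Set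
FlipVia T T' i j k l =
    T ∋[ i , j ] × ¬ (T' ∋[ i , j ]) × T' ∋[ k , l ] × ¬ (T ∋[ k , l ])
  × (∀ x y → ¬ ((x ≡ i) × (y ≡ j)) → ¬ ((x ≡ k) × (y ≡ l)) →
       lookup (lookup T x) y ≡ lookup (lookup T' x) y)

Flip : {n : ℕ} → DiagSet n → DiagSet n → Set
Flip {n} T T' = ∃[ i ] ∃[ j ] ∃[ k ] ∃[ l ] FlipVia {n} T T' i j k l

Near : {n : ℕ} → DiagSet n → DiagSet n → Set
Near T T' = (T ≡ T') ⊎ Flip T T'

-- (n-2)-loop based at T₀, written as the list of its terms
-- T₀ , T₁ , … , T_k (= T₀).  All terms are triangulations, consecutive
-- terms are (n-2)-near, and the first and last terms are T₀.
IsLoop : (n : ℕ) → DiagSet n → List (DiagSet n) → Set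
IsLoop n T₀ σ =
    All (IsTriangulation n) σ
  × Linked (Near {n}) σ
  × ((σ ≡ T₀ ∷ []) ⊎ (∃[ mid ] (σ ≡ T₀ ∷ (mid ∷ʳ T₀))))

-- (1) repeating a term (this is also the "stretch" operation).
Stretch : {n : ℕ} → List (DiagSet n) → List (DiagSet n) → Set
Stretch σ σ' = ∃[ pre ] ∃[ x ] ∃[ post ]
  ((σ ≡ pre ++ x ∷ post) × (σ' ≡ pre ++ x ∷ x ∷ post))

-- (2) one step of a grid: two loops of the same length whose i-th terms
-- are (n-2)-near for every i.  (A grid is a finite sequence of such
-- steps; this is taken care of by the equivalence closure.)
GridStep : {n : ℕ} → List (DiagSet n) → List (DiagSet n) → Set
GridStep = Pointwise Near

HomStep : (n : ℕ) → DiagSet n → List (DiagSet n) → List (DiagSet n) → Set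
HomStep n T₀ σ σ' =
  IsLoop n T₀ σ × IsLoop n T₀ σ' × (Stretch σ σ' ⊎ GridStep σ σ')

HomotopicA : (n : ℕ) → DiagSet n → List (DiagSet n) → List (DiagSet n) → Set
HomotopicA n T₀ = EqClosure (HomStep n T₀)

Insert : {n : ℕ} → List (DiagSet n) → List (DiagSet n) → Set
Insert σ σ' = ∃[ pre ] ∃[ x ] ∃[ y ] ∃[ post ]
  ((σ ≡ pre ++ x ∷ x ∷ post) × (σ' ≡ pre ++ x ∷ y ∷ x ∷ post) × Flip x y)

-- a , b , c , d form a geodesic 4-cycle of Γ (a square): two flips
-- performed in two non-overlapping quadrilaterals, i.e. the flip
-- e₁ ↦ e₁' and the flip e₂ ↦ e₂' commute:
--   a —(e₁↦e₁')→ b —(e₂↦e₂')→ c —(e₁'↦e₁)→ d —(e₂'↦e₂)→ a.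
GeodesicSquare : {n : ℕ} → DiagSet n → DiagSet n → DiagSet n → DiagSet n → Set
GeodesicSquare {n} a b c d =
  ∃[ i₁ ] ∃[ j₁ ] ∃[ k₁ ] ∃[ l₁ ] ∃[ i₂ ] ∃[ j₂ ] ∃[ k₂ ] ∃[ l₂ ]
    ( FlipVia {n} a b i₁ j₁ k₁ l₁
    × FlipVia {n} b c i₂ j₂ k₂ l₂
    × FlipVia {n} c d k₁ l₁ i₁ j₁
    × FlipVia {n} d a k₂ l₂ i₂ j₂ )

Switch : {n : ℕ} → List (DiagSet n) → List (DiagSet n) → Set
Switch σ σ' = ∃[ pre ] ∃[ a ] ∃[ b ] ∃[ c ] ∃[ d ] ∃[ post ]
  ( (σ ≡ pre ++ a ∷ b ∷ c ∷ post) × (σ' ≡ pre ++ a ∷ d ∷ c ∷ post)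
  × (a ≢ b) × (a ≢ c) × (a ≢ d) × (b ≢ c) × (b ≢ d) × (c ≢ d)
  × GeodesicSquare a b c d )

OpStep : (n : ℕ) → DiagSet n → List (DiagSet n) → List (DiagSet n) → Set
OpStep n T₀ σ σ' =
  IsLoop n T₀ σ × IsLoop n T₀ σ' × (Stretch σ σ' ⊎ Insert σ σ' ⊎ Switch σ σ')

TransformableByOps : (n : ℕ) → DiagSet n → List (DiagSet n) → List (DiagSet n) → Set
TransformableByOps n T₀ = EqClosure (OpStep n T₀)

module Submission where

-- The homotopy ≃_A is generated by stretches, which are operations
-- already, and by grid steps σ ⇉ τ between loops of equal length whose i-th
-- terms are near.  A grid step is realised by a sweep: after stretching the
-- base point, the current loop is (front of τ) ++ t , s , (back of σ), and
-- the path t , s , s' is replaced by t , t' , s' where t' is the next term of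
-- τ.  Such a replacement inside a closed 4-walk of the flip graph Γ is done
-- by de-stretches and de-insertions when the walk is degenerate, and by a
-- switch otherwise.  The geometric input is that Γ is triangle-free and that
-- a 4-cycle of flips a , b , c , d with a ≠ c, b ≠ d is a geodesic square;
-- both follow from the uniqueness of flips (in a triangulation, a diagonal has
-- at most one replacement, and it crosses the removed one).

open import Defs
open import Data.List using (List)
open import Data.Nat using (ℕ)

open import Data.Nat using (_<_; _≤_; _+_; s≤s)
open import Data.Nat.Properties
  using (<-cmp; <-trans; <-irrefl; <⇒≢; <-≤-trans; ≤-trans; ≤-pred; +-comm; +-suc; n≮0)
open import Data.Fin using (toℕ)
open import Data.Fin.Properties using (toℕ-injective; toℕ<n) renaming (_≟_ to _≟F_)
open import Data.Bool using (Bool; true; false)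
import Data.Bool.Properties as BoolP
open import Data.Vec using (Vec; lookup)
open import Data.Vec.Properties using (tabulate∘lookup; tabulate-cong)
import Data.Vec.Properties as VecP
open import Data.Product using (Σ; ∃-syntax; _×_; _,_; proj₁; proj₂; swap)
import Data.Product as Product
open import Data.Product.Properties using (×-≡,≡→≡)
import Data.Product.Properties as ProductP
open import Data.Sum using (_⊎_; inj₁; inj₂)
import Data.Sum as Sum
open import Data.Empty using (⊥; ⊥-elim)
open import Data.Maybe using (just)
open import Data.Maybe.Properties using (just-injective)
open import Data.List using ([]; _∷_; _++_; _∷ʳ_; head; last; initLast; _∷ʳ′_)
open import Data.List.Properties using (++-assoc)
import Data.List.Relation.Unary.All as All
open import Data.List.Relation.Unary.All using (_∷_)
open import Data.List.Relation.Unary.All.Properties using (++⁺; ++⁻ˡ; ++⁻ʳ)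
import Data.List.Relation.Unary.Linked as Linked
open import Data.List.Relation.Unary.Linked using (Linked; [-]; _∷_)
open import Data.List.Relation.Binary.Pointwise using (Pointwise; []; _∷_)
open import Function using (_∘_)
open import Relation.Nullary using (¬_; Dec; yes; no)
open import Relation.Nullary.Decidable using (_×-dec_; _⊎-dec_)
open import Relation.Binary.PropositionalEquality
open import Relation.Binary.Definitions using (tri<; tri≈; tri>)
import Relation.Binary.Construct.Closure.Equivalence as EqC
open import Relation.Binary.Construct.Closure.ReflexiveTransitive using (ε; _◅_; _◅◅_)
open import Relation.Binary.Construct.Closure.Symmetric using (fwd; bwd)

Cross : ℕ → ℕ → ℕ → ℕ → Set
Cross i j k l = (i < k × k < j × j < l) ⊎ (k < i × i < l × l < j)

cross-sym : ∀ {i j k l} → Cross i j k l → Cross k l i j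
cross-sym (inj₁ c) = inj₂ c
cross-sym (inj₂ c) = inj₁ c

two-apart : ∀ {a m b} → a < m → m < b → a + 2 ≤ b
two-apart {a} {m} {b} a<m m<b = subst (_≤ b) (+-comm 2 a) (≤-trans (s≤s a<m) m<b)

shared-start : ∀ {u v q} → ¬ Cross u v u q
shared-start (inj₁ (u<u , _)) = <-irrefl refl u<u
shared-start (inj₂ (u<u , _)) = <-irrefl refl u<u

shared-end : ∀ {u v p} → ¬ Cross u v p v
shared-end (inj₁ (_ , _ , v<v)) = <-irrefl refl v<v
shared-end (inj₂ (_ , _ , v<v)) = <-irrefl refl v<v

end-is-start : ∀ {u v q} → ¬ Cross u v v q
end-is-start (inj₁ (_ , v<v , _)) = <-irrefl refl v<v
end-is-start (inj₂ (v<u , u<q , q<v)) = <-irrefl refl (<-trans v<u (<-trans u<q q<v))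

start-is-end : ∀ {u v p} → ¬ Cross u v p u
start-is-end (inj₁ (u<p , p<v , v<u)) = <-irrefl refl (<-trans u<p (<-trans p<v v<u))
start-is-end (inj₂ (_ , u<u , _)) = <-irrefl refl u<u

data Side {V : Set} (a b c d : V) : V → V → Set where
  ab : Side a b c d a b
  bc : Side a b c d b c
  cd : Side a b c d c d
  ad : Side a b c d a d

side-map : ∀ {V W : Set} (f : V → W) {a b c d u v} →
           Side a b c d u v → Side (f a) (f b) (f c) (f d) (f u) (f v)
side-map f ab = ab
side-map f bc = bc
side-map f cd = cd
side-map f ad = ad

Diagonal : {V : Set} → V → V → V → V → V → V → Set
Diagonal a b c d r s = (r ≡ a × s ≡ c) ⊎ (r ≡ b × s ≡ d)

diagonal-map : ∀ {V W : Set} (f : V → W) {a b c d r s} →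
               Diagonal a b c d r s → Diagonal (f a) (f b) (f c) (f d) (f r) (f s)
diagonal-map f = Sum.map (Product.map (cong f) (cong f)) (Product.map (cong f) (cong f))

crossing-a-diagonal : ∀ {a b c d p q r s} →
  Diagonal a b c d p q → Cross p q r s → Cross a c r s ⊎ Cross b d r s
crossing-a-diagonal (inj₁ (refl , refl)) pq×rs = inj₁ pq×rs
crossing-a-diagonal (inj₂ (refl , refl)) pq×rs = inj₂ pq×rs

-- A side never crosses a diagonal: they share an endpoint.
side-diagonal-no-cross : ∀ {a b c d u v p q} →
  Side a b c d u v → Diagonal a b c d p q → ¬ Cross u v p q
side-diagonal-no-cross ab (inj₁ (refl , refl)) = shared-start
side-diagonal-no-cross ab (inj₂ (refl , refl)) = end-is-start
side-diagonal-no-cross bc (inj₁ (refl , refl)) = shared-end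
side-diagonal-no-cross bc (inj₂ (refl , refl)) = shared-start
side-diagonal-no-cross cd (inj₁ (refl , refl)) = start-is-end
side-diagonal-no-cross cd (inj₂ (refl , refl)) = shared-end
side-diagonal-no-cross ad (inj₁ (refl , refl)) = shared-start
side-diagonal-no-cross ad (inj₂ (refl , refl)) = shared-end

side-not-diagonal : ∀ {a b c d u v p q} → a < b → b < c → c < d →
  Side a b c d u v → Diagonal a b c d p q → ¬ (u ≡ p × v ≡ q)
side-not-diagonal a<b b<c c<d ab (inj₁ (refl , refl)) (_ , b≡c) = <⇒≢ b<c b≡c
side-not-diagonal a<b b<c c<d ab (inj₂ (refl , refl)) (a≡b , _) = <⇒≢ a<b a≡b
side-not-diagonal a<b b<c c<d bc (inj₁ (refl , refl)) (b≡a , _) = <⇒≢ a<b (sym b≡a)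
side-not-diagonal a<b b<c c<d bc (inj₂ (refl , refl)) (_ , c≡d) = <⇒≢ c<d c≡d
side-not-diagonal a<b b<c c<d cd (inj₁ (refl , refl)) (c≡a , _) = <⇒≢ (<-trans a<b b<c) (sym c≡a)
side-not-diagonal a<b b<c c<d cd (inj₂ (refl , refl)) (c≡b , _) = <⇒≢ b<c (sym c≡b)
side-not-diagonal a<b b<c c<d ad (inj₁ (refl , refl)) (_ , d≡c) = <⇒≢ c<d (sym d≡c)
side-not-diagonal a<b b<c c<d ad (inj₂ (refl , refl)) (a≡b , _) = <⇒≢ a<b a≡b

crossing-diagonal-not-side : ∀ {a b c d r s} → a < b → b < c → c < d →
  Cross a c r s ⊎ Cross b d r s → (∀ {u v} → Side a b c d u v → ¬ Cross u v r s) →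
  Diagonal a b c d r s
crossing-diagonal-not-side {a} {b} {c} {d} {r} {s} a<b b<c c<d
  (inj₁ (inj₁ (a<r , r<c , c<s))) noSide
  with <-cmp r b | <-cmp s d
... | tri< r<b _ _ | _ = ⊥-elim (noSide ab (inj₁ (a<r , r<b , <-trans b<c c<s)))
... | _ | tri< s<d _ _ = ⊥-elim (noSide cd (inj₂ (r<c , c<s , s<d)))
... | _ | tri> _ _ d<s = ⊥-elim (noSide ad (inj₁ (a<r , <-trans r<c c<d , d<s)))
... | tri> _ _ b<r | tri≈ _ s≡d _ =
  ⊥-elim (noSide bc (inj₁ (b<r , r<c , subst (c <_) (sym s≡d) c<d)))
... | tri≈ _ r≡b _ | tri≈ _ s≡d _ = inj₂ (r≡b , s≡d)
crossing-diagonal-not-side a<b b<c c<d (inj₁ (inj₂ (r<a , a<s , s<c))) noSide =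
  ⊥-elim (noSide ad (inj₂ (r<a , a<s , <-trans s<c c<d)))
crossing-diagonal-not-side a<b b<c c<d (inj₂ (inj₁ (b<r , r<d , d<s))) noSide =
  ⊥-elim (noSide ad (inj₁ (<-trans a<b b<r , r<d , d<s)))
crossing-diagonal-not-side {a} {b} {c} {d} {r} {s} a<b b<c c<d
  (inj₂ (inj₂ (r<b , b<s , s<d))) noSide
  with <-cmp r a | <-cmp s c
... | tri< r<a _ _ | _ = ⊥-elim (noSide ad (inj₂ (r<a , <-trans a<b b<s , s<d)))
... | tri> _ _ a<r | _ = ⊥-elim (noSide ab (inj₁ (a<r , r<b , b<s)))
... | _ | tri< s<c _ _ = ⊥-elim (noSide bc (inj₂ (r<b , b<s , s<c)))
... | _ | tri> _ _ c<s = ⊥-elim (noSide cd (inj₂ (<-trans r<b b<c , c<s , s<d)))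
... | tri≈ _ r≡a _ | tri≈ _ s≡c _ = inj₁ (r≡a , s≡c)

uncrossed-diagonals⇒uncrossed-sides : ∀ {a b c d p q u v} → a < b → b < c → c < d →
  ¬ Cross a c p q → ¬ Cross b d p q → Side a b c d u v → ¬ Cross u v p q
uncrossed-diagonals⇒uncrossed-sides {c = c} {q = q} a<b b<c c<d nAC nBD ab (inj₁ (a<p , p<b , b<q))
  with <-cmp q c
... | tri< q<c _ _ = nBD (inj₂ (p<b , b<q , <-trans q<c c<d))
... | tri≈ _ q≡c _ = nBD (inj₂ (p<b , b<q , subst (_< _) (sym q≡c) c<d))
... | tri> _ _ c<q = nAC (inj₁ (a<p , <-trans p<b b<c , c<q))
uncrossed-diagonals⇒uncrossed-sides a<b b<c c<d nAC nBD ab (inj₂ (p<a , a<q , q<b)) =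
  nAC (inj₂ (p<a , a<q , <-trans q<b b<c))
uncrossed-diagonals⇒uncrossed-sides a<b b<c c<d nAC nBD bc (inj₁ (b<p , p<c , c<q)) =
  nAC (inj₁ (<-trans a<b b<p , p<c , c<q))
uncrossed-diagonals⇒uncrossed-sides a<b b<c c<d nAC nBD bc (inj₂ (p<b , b<q , q<c)) =
  nBD (inj₂ (p<b , b<q , <-trans q<c c<d))
uncrossed-diagonals⇒uncrossed-sides a<b b<c c<d nAC nBD cd (inj₁ (c<p , p<d , d<q)) =
  nBD (inj₁ (<-trans b<c c<p , p<d , d<q))
uncrossed-diagonals⇒uncrossed-sides {b = b} {p = p} a<b b<c c<d nAC nBD cd (inj₂ (p<c , c<q , q<d))
  with <-cmp p b
... | tri< p<b _ _ = nBD (inj₂ (p<b , <-trans b<c c<q , q<d))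
... | tri≈ _ p≡b _ = nAC (inj₁ (subst (_ <_) (sym p≡b) a<b , p<c , c<q))
... | tri> _ _ b<p = nAC (inj₁ (<-trans a<b b<p , p<c , c<q))
uncrossed-diagonals⇒uncrossed-sides {c = c} {p = p} a<b b<c c<d nAC nBD ad (inj₁ (a<p , p<d , d<q))
  with <-cmp p c
... | tri< p<c _ _ = nAC (inj₁ (a<p , p<c , <-trans c<d d<q))
... | tri≈ _ p≡c _ = nBD (inj₁ (subst (_ <_) (sym p≡c) b<c , p<d , d<q))
... | tri> _ _ c<p = nBD (inj₁ (<-trans b<c c<p , p<d , d<q))
uncrossed-diagonals⇒uncrossed-sides {c = c} {q = q} a<b b<c c<d nAC nBD ad (inj₂ (p<a , a<q , q<d))
  with <-cmp q c
... | tri< q<c _ _ = nAC (inj₂ (p<a , a<q , q<c))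
... | tri≈ _ q≡c _ = nBD (inj₂ (<-trans p<a a<b , subst (_ <_) (sym q≡c) b<c , q<d))
... | tri> _ _ c<q = nBD (inj₂ (<-trans p<a a<b , <-trans b<c c<q , q<d))

matched : ∀ {A : Set} {x y p p' : A} → x ≡ p ⊎ x ≡ p' → y ≡ p ⊎ y ≡ p' → x ≢ y →
          (x ≡ p × y ≡ p') ⊎ (x ≡ p' × y ≡ p)
matched (inj₁ x≡p) (inj₁ y≡p) x≢y = ⊥-elim (x≢y (trans x≡p (sym y≡p)))
matched (inj₁ x≡p) (inj₂ y≡p') _ = inj₁ (x≡p , y≡p')
matched (inj₂ x≡p') (inj₁ y≡p) _ = inj₂ (x≡p' , y≡p)
matched (inj₂ x≡p') (inj₂ y≡p') x≢y = ⊥-elim (x≢y (trans x≡p' (sym y≡p')))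

module _ {n : ℕ} where

  -- (k , l) can replace the diagonal (e₁ , e₂) of x: it is a diagonal outside
  -- x crossing no diagonal of x other than (e₁ , e₂).
  Candidate : DiagSet n → Vert n → Vert n → Vert n → Vert n → Set
  Candidate x e₁ e₂ k l = IsDiagonal n k l × ¬ (x ∋[ k , l ])
    × (∀ p q → x ∋[ p , q ] → ¬ ((p ≡ e₁) × (q ≡ e₂)) → ¬ Crosses p q k l)

  -- Maximality of a triangulation forces a candidate to cross the diagonal it
  -- replaces.
  candidate-crosses : ∀ {x e₁ e₂ k l} → IsTriangulation n x →
                      Candidate x e₁ e₂ k l → Crosses e₁ e₂ k l
  candidate-crosses {x} {e₁} {e₂} {k} {l} (_ , maximal) (diag , k∉x , noCross)
    with maximal k l diag k∉x
  ... | p , q , x∋pq , kl×pq with (p ≟F e₁) ×-dec (q ≟F e₂)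
  ...   | yes (refl , refl) = cross-sym kl×pq
  ...   | no pq≢e = ⊥-elim (noCross p q x∋pq pq≢e (cross-sym kl×pq))

  crossing⇒diagonal : ∀ {u v r s : Vert n} → Crosses u v r s → IsDiagonal n u v
  crossing⇒diagonal {u} {v} {r} {s} (inj₁ (u<r , r<v , v<s)) =
    two-apart u<r r<v , λ (_ , v≡last) → <-irrefl refl
      (<-≤-trans (subst (_< toℕ s) v≡last v<s)
                 (≤-pred (subst (toℕ s <_) (+-suc n 2) (toℕ<n s))))
  crossing⇒diagonal {u} {v} {r} {s} (inj₂ (r<u , u<s , s<v)) =
    two-apart u<s s<v , λ (u≡0 , _) → n≮0 (subst (toℕ r <_) u≡0 r<u)

  -- A chord (u , v) crossing no diagonal of the triangulation x is crossed by
  -- no candidate either: otherwise it would be a diagonal outside x, hence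
  -- (by maximality) crossed by x.
  candidate-avoids : ∀ {x e₁ e₂ r s} → IsTriangulation n x → Candidate x e₁ e₂ r s →
    (u v : Vert n) → ¬ ((u ≡ e₁) × (v ≡ e₂)) →
    (∀ p q → x ∋[ p , q ] → ¬ Crosses u v p q) → ¬ Crosses u v r s
  candidate-avoids {x} (_ , maximal) (_ , _ , noCross) u v uv≢e uncrossed uv×rs
    with lookup (lookup x u) v BoolP.≟ true
  ... | yes x∋uv = noCross u v x∋uv uv≢e uv×rs
  ... | no uv∉x with maximal u v (crossing⇒diagonal uv×rs) uv∉x
  ...   | p , q , x∋pq , uv×pq = uncrossed p q x∋pq uv×pq

  candidate-in-quadrilateral : ∀ {x e₁ e₂ r s a b c d} →
    IsTriangulation n x → Candidate x e₁ e₂ r s →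
    toℕ a < toℕ b → toℕ b < toℕ c → toℕ c < toℕ d → Diagonal a b c d e₁ e₂ →
    (∀ p q → x ∋[ p , q ] → ¬ ((p ≡ e₁) × (q ≡ e₂)) →
       ¬ Crosses a c p q × ¬ Crosses b d p q) →
    Diagonal a b c d r s
  candidate-in-quadrilateral {x} {e₁} {e₂} {r} {s} {a} {b} {c} {d}
    tri cand a<b b<c c<d e-diagonal shielded =
    Sum.map (Product.map toℕ-injective toℕ-injective)
            (Product.map toℕ-injective toℕ-injective)
            (crossing-diagonal-not-side a<b b<c c<d crosses-diagonal avoids-sides)
    where
      crosses-diagonal : Cross (toℕ a) (toℕ c) (toℕ r) (toℕ s)
                       ⊎ Cross (toℕ b) (toℕ d) (toℕ r) (toℕ s)
      crosses-diagonal = crossing-a-diagonal (diagonal-map toℕ e-diagonal)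
                                             (candidate-crosses {x = x} tri cand)

      side-uncrossed : ∀ {u v} → Side a b c d u v → ∀ p q → x ∋[ p , q ] → ¬ Crosses u v p q
      side-uncrossed side p q x∋pq with (p ≟F e₁) ×-dec (q ≟F e₂)
      ... | yes (refl , refl) =
        side-diagonal-no-cross (side-map toℕ side) (diagonal-map toℕ e-diagonal)
      ... | no pq≢e = uncrossed-diagonals⇒uncrossed-sides a<b b<c c<d
        (proj₁ (shielded p q x∋pq pq≢e)) (proj₂ (shielded p q x∋pq pq≢e)) (side-map toℕ side)

      side-avoided : ∀ {u v} → Side a b c d u v → ¬ Crosses u v r s
      side-avoided {u} {v} side = candidate-avoids {x = x} tri cand u v
        (λ (u≡e₁ , v≡e₂) → side-not-diagonal a<b b<c c<d (side-map toℕ side)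
                              (diagonal-map toℕ e-diagonal) (cong toℕ u≡e₁ , cong toℕ v≡e₂))
        (side-uncrossed side)

      avoids-sides : ∀ {u v} → Side (toℕ a) (toℕ b) (toℕ c) (toℕ d) u v → ¬ Cross u v (toℕ r) (toℕ s)
      avoids-sides ab = side-avoided ab
      avoids-sides bc = side-avoided bc
      avoids-sides cd = side-avoided cd
      avoids-sides ad = side-avoided ad

  shielded : ∀ {x e₁ e₂ k l} → IsTriangulation n x → x ∋[ e₁ , e₂ ] → Candidate x e₁ e₂ k l →
    ∀ p q → x ∋[ p , q ] → ¬ ((p ≡ e₁) × (q ≡ e₂)) → ¬ Crosses e₁ e₂ p q × ¬ Crosses k l p q
  shielded {e₁ = e₁} {e₂} ((_ , noCrossing) , _) x∋e (_ , _ , candNoCross) p q x∋pq pq≢e =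
    (λ e×pq → noCrossing p q e₁ e₂ x∋pq x∋e (cross-sym e×pq)) ,
    (λ kl×pq → candNoCross p q x∋pq pq≢e (cross-sym kl×pq))

  -- The first candidate k l crosses e, and e , k l are
  -- the diagonals of a quadrilateral to which the second candidate must belong.
  candidate-unique : ∀ {x e₁ e₂ k l r s} → IsTriangulation n x → x ∋[ e₁ , e₂ ] →
    Candidate x e₁ e₂ k l → Candidate x e₁ e₂ r s → (k ≡ r) × (l ≡ s)
  candidate-unique {x} {e₁} {e₂} {k} {l} {r} {s} tri x∋e candKL candRS
    with candidate-crosses {x = x} tri candKL
  ... | inj₁ (e₁<k , k<e₂ , e₂<l) =
    second-diagonal (candidate-in-quadrilateral {x = x} tri candRS e₁<k k<e₂ e₂<l
                       (inj₁ (refl , refl)) (shielded {x = x} tri x∋e candKL))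
    where
      second-diagonal : Diagonal e₁ k e₂ l r s → (k ≡ r) × (l ≡ s)
      second-diagonal (inj₁ (refl , refl)) = ⊥-elim (proj₁ (proj₂ candRS) x∋e)
      second-diagonal (inj₂ (r≡k , s≡l)) = sym r≡k , sym s≡l
  ... | inj₂ (k<e₁ , e₁<l , l<e₂) =
    first-diagonal (candidate-in-quadrilateral {x = x} tri candRS k<e₁ e₁<l l<e₂
                      (inj₂ (refl , refl))
                      (λ p q x∋pq pq≢e → swap (shielded {x = x} tri x∋e candKL p q x∋pq pq≢e)))
    where
      first-diagonal : Diagonal k e₁ l e₂ r s → (k ≡ r) × (l ≡ s)
      first-diagonal (inj₁ (r≡k , s≡l)) = sym r≡k , sym s≡l
      first-diagonal (inj₂ (refl , refl)) = ⊥-elim (proj₁ (proj₂ candRS) x∋e)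

  -- Positions of the incidence matrix, i.e. ordered pairs of vertices; flips
  -- are best analysed as changes of entries at positions.
  Pos : Set
  Pos = Vert n × Vert n

  _≟P_ : (p q : Pos) → Dec (p ≡ q)
  _≟P_ = ProductP.≡-dec _≟F_ _≟F_

  _at_ : DiagSet n → Pos → Bool
  T at (i , j) = lookup (lookup T i) j

  CrossesP : Pos → Pos → Set
  CrossesP (i , j) (k , l) = Crosses i j k l

  record FlipAt (T T' : DiagSet n) (p q : Pos) : Set where
    field
      removed-before : T at p ≡ true
      removed-after  : T' at p ≡ false
      added-after    : T' at q ≡ true
      added-before   : T at q ≡ false
      unchanged      : ∀ r → r ≢ p → r ≢ q → T at r ≡ T' at r
  open FlipAt

  true≢false : ∀ {b} → b ≡ true → b ≡ false → ⊥
  true≢false refl ()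

  apart : ∀ T {p q} → T at p ≡ true → T at q ≡ false → p ≢ q
  apart T Tp Tq refl = true≢false Tp Tq

  entries-ext : ∀ {T T'} → (∀ r → T at r ≡ T' at r) → T ≡ T'
  entries-ext {T} {T'} same = row-ext (λ i → row-ext (λ j → same (i , j)))
    where
      row-ext : ∀ {A : Set} {m} {xs ys : Vec A m} →
                (∀ i → lookup xs i ≡ lookup ys i) → xs ≡ ys
      row-ext {xs = xs} {ys} pointwise =
        trans (sym (tabulate∘lookup xs)) (trans (tabulate-cong pointwise) (tabulate∘lookup ys))

  flipVia⇒flipAt : ∀ {T T' i j k l} → FlipVia T T' i j k l → FlipAt T T' (i , j) (k , l)
  flipVia⇒flipAt (ij∈T , ij∉T' , kl∈T' , kl∉T , others) = record
    { removed-before = ij∈T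
    ; removed-after  = ¬-true ij∉T'
    ; added-after    = kl∈T'
    ; added-before   = ¬-true kl∉T
    ; unchanged      = λ (x , y) r≢ij r≢kl →
        others x y (λ { (refl , refl) → r≢ij refl }) (λ { (refl , refl) → r≢kl refl })
    }
    where
      ¬-true : ∀ {b} → ¬ b ≡ true → b ≡ false
      ¬-true {false} _ = refl
      ¬-true {true} b≢true = ⊥-elim (b≢true refl)

  flipAt⇒flipVia : ∀ {T T'} (p q : Pos) → FlipAt T T' p q →
                   FlipVia T T' (proj₁ p) (proj₂ p) (proj₁ q) (proj₂ q)
  flipAt⇒flipVia (i , j) (k , l) F =
    removed-before F , (λ ij∈T' → true≢false ij∈T' (removed-after F)) ,
    added-after F , (λ kl∈T → true≢false kl∈T (added-before F)) ,
    λ x y xy≢ij xy≢kl → unchanged F (x , y) (λ { refl → xy≢ij (refl , refl) })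
                                             (λ { refl → xy≢kl (refl , refl) })

  flipAt-sym : ∀ {T T' p q} → FlipAt T T' p q → FlipAt T' T q p
  flipAt-sym F = record
    { removed-before = added-after F
    ; removed-after  = added-before F
    ; added-after    = removed-before F
    ; added-before   = removed-after F
    ; unchanged      = λ r r≢q r≢p → sym (unchanged F r r≢p r≢q)
    }

  flip-changes : ∀ {T T' p q} → FlipAt T T' p q → T ≢ T'
  flip-changes F refl = true≢false (removed-before F) (removed-after F)

  flip⇒flipAt : ∀ {T T'} → Flip T T' → Σ Pos λ p → Σ Pos λ q → FlipAt T T' p q
  flip⇒flipAt (i , j , k , l , F) = (i , j) , (k , l) , flipVia⇒flipAt F

  stays-in : ∀ {T T' p q r} → FlipAt T T' p q → T at r ≡ true → r ≢ p → T' at r ≡ true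
  stays-in {T} {r = r} F Tr r≢p =
    trans (sym (unchanged F r r≢p (apart T Tr (added-before F)))) Tr

  stays-out : ∀ {T T' p q r} → FlipAt T T' p q → T at r ≡ false → r ≢ q → T' at r ≡ false
  stays-out {T} {r = r} F Tr r≢q =
    trans (sym (unchanged F r (λ r≡p → apart T (removed-before F) Tr (sym r≡p)) r≢q)) Tr

  lost-in-flip : ∀ {T T' p q r} → FlipAt T T' p q → T at r ≡ true → T' at r ≡ false → r ≡ p
  lost-in-flip {p = p} {r = r} F Tr T'r with r ≟P p
  ... | yes r≡p = r≡p
  ... | no r≢p = ⊥-elim (true≢false (stays-in F Tr r≢p) T'r)

  lost-in-two-flips : ∀ {a b c p q p' q' r} → FlipAt a b p q → FlipAt b c p' q' →
    a at r ≡ true → c at r ≡ false → r ≡ p ⊎ r ≡ p'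
  lost-in-two-flips {p = p} {p' = p'} {r = r} F F' ar cr with r ≟P p
  ... | yes r≡p = inj₁ r≡p
  ... | no r≢p = inj₂ (lost-in-flip F' (stays-in F ar r≢p) cr)

  gained-in-two-flips : ∀ {a b c p q p' q' r} → FlipAt a b p q → FlipAt b c p' q' →
    a at r ≡ false → c at r ≡ true → r ≡ q ⊎ r ≡ q'
  gained-in-two-flips F F' ar cr =
    Sum.swap (lost-in-two-flips (flipAt-sym F') (flipAt-sym F) cr ar)

  flip-determined : ∀ {a b d p q} → FlipAt a b p q → FlipAt a d p q → b ≡ d
  flip-determined {a} {b} {d} {p} {q} F G = entries-ext same
    where
      same : ∀ r → b at r ≡ d at r
      same r with r ≟P p | r ≟P q
      ... | yes refl | _ = trans (removed-after F) (sym (removed-after G))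
      ... | no _ | yes refl = trans (added-after F) (sym (added-after G))
      ... | no r≢p | no r≢q = trans (sym (unchanged F r r≢p r≢q)) (unchanged G r r≢p r≢q)

  candidate-within : ∀ {x y} (e q : Pos) → IsSimplex n y → y at q ≡ true → x at q ≡ false →
    (∀ r → x at r ≡ true → r ≢ e → y at r ≡ true) →
    Candidate x (proj₁ e) (proj₂ e) (proj₁ q) (proj₂ q)
  candidate-within (e₁ , e₂) (k , l) (diagonals , noCrossing) yq xq x-e⊆y =
    diagonals k l yq , (λ xq′ → true≢false xq′ xq) ,
    λ p p′ x∋pp′ pp′≢e → noCrossing p p′ k l
      (x-e⊆y (p , p′) x∋pp′ (λ { refl → pp′≢e (refl , refl) })) yq

  flip-candidate : ∀ {x y e f} → FlipAt x y e f → IsSimplex n y →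
    Candidate x (proj₁ e) (proj₂ e) (proj₁ f) (proj₂ f)
  flip-candidate {x} {y} {e} {f} F sy =
    candidate-within {x = x} {y = y} e f sy (added-after F) (added-before F)
                     (λ r xr r≢e → stays-in F xr r≢e)

  flip-crosses : ∀ {x y e f} → IsTriangulation n x → IsSimplex n y → FlipAt x y e f → CrossesP e f
  flip-crosses {x} {e = _ , _} {_ , _} tx sy F = candidate-crosses {x = x} tx (flip-candidate F sy)

  replacement-unique : ∀ {x} (e f h : Pos) → IsTriangulation n x → x at e ≡ true →
    Candidate x (proj₁ e) (proj₂ e) (proj₁ f) (proj₂ f) →
    Candidate x (proj₁ e) (proj₂ e) (proj₁ h) (proj₂ h) → f ≡ h
  replacement-unique {x} (_ , _) (_ , _) (_ , _) tx xe cf ch =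
    ×-≡,≡→≡ (candidate-unique {x = x} tx xe cf ch)

  simplex-no-cross : ∀ {y e f} → IsSimplex n y → y at e ≡ true → y at f ≡ true → ¬ CrossesP e f
  simplex-no-cross {e = e₁ , e₂} {f₁ , f₂} (_ , noCrossing) ye yf = noCrossing e₁ e₂ f₁ f₂ ye yf

  -- Two consecutive flips a → b → c with a ≠ c are independent: the second
  -- neither flips the diagonal just added (by uniqueness of flips that would
  -- return to a) nor adds back the one just removed (it crosses the added one).
  second-flip-independent : ∀ {a b c e f g h} →
    IsTriangulation n a → IsSimplex n b → IsSimplex n c →
    FlipAt a b e f → FlipAt b c g h → a ≢ c → (g ≢ f) × (h ≢ e)
  second-flip-independent {a} {b} {c} {e} {f} {g} {h} ta sb sc F G a≢c with g ≟P f | h ≟P e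
  ... | yes refl | yes refl = ⊥-elim (a≢c (flip-determined (flipAt-sym F) G))
  ... | yes refl | no h≢e =
    ⊥-elim (apart b (added-after F) (added-before G)
      (replacement-unique {x = a} e f h ta (removed-before F) (flip-candidate F sb)
        (candidate-within {x = a} {y = c} e h sc (added-after G)
          (stays-out (flipAt-sym F) (added-before G) h≢e)
          (λ r ar r≢e → stays-in G (stays-in F ar r≢e) (apart a ar (added-before F))))))
  ... | no g≢f | yes refl =
    ⊥-elim (simplex-no-cross {y = c} sc (added-after G) (stays-in G (added-after F) (g≢f ∘ sym))
              (flip-crosses ta sb F))
  ... | no g≢f | no h≢e = g≢f , h≢e

  -- The flip graph is triangle-free: with independent flips a → b → c, both
  -- removed diagonals are lost from a to c, while a single flip loses one.
  triangle-free-at : ∀ {a b c e f g h u w} → IsTriangulation n a → IsSimplex n b → IsSimplex n c →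
    FlipAt a b e f → FlipAt b c g h → FlipAt a c u w → ⊥
  triangle-free-at {a} {b} {c} {e} {f} {g} {h} {u} ta sb sc F G H
    with second-flip-independent ta sb sc F G (flip-changes H)
  ... | g≢f , h≢e = apart b (removed-before G) (removed-after F) (trans g≡u (sym e≡u))
    where
      e≡u : e ≡ u
      e≡u = lost-in-flip H (removed-before F) (stays-out G (removed-after F) (h≢e ∘ sym))
      g≡u : g ≡ u
      g≡u = lost-in-flip H (stays-in (flipAt-sym F) (removed-before G) g≢f) (removed-after G)

  triangle-free : ∀ {a b c} → IsTriangulation n a → IsTriangulation n b → IsTriangulation n c →
    Flip a b → Flip b c → Flip a c → ⊥
  triangle-free {a} {b} {c} ta tb tc Fab Fbc Fac
    with flip⇒flipAt {a} {b} Fab | flip⇒flipAt {b} {c} Fbc | flip⇒flipAt {a} {c} Fac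
  ... | _ , _ , F | _ , _ , G | _ , _ , H = triangle-free-at ta (proj₁ tb) (proj₁ tc) F G H

  geodesic-square : ∀ {a b c d} (e f g h : Pos) → FlipAt a b e f → FlipAt b c g h →
    FlipAt c d f e → FlipAt d a h g → GeodesicSquare a b c d
  geodesic-square (e₁ , e₂) (f₁ , f₂) (g₁ , g₂) (h₁ , h₂) F G H K =
    e₁ , e₂ , f₁ , f₂ , g₁ , g₂ , h₁ , h₂ ,
    flipAt⇒flipVia _ _ F , flipAt⇒flipVia _ _ G , flipAt⇒flipVia _ _ H , flipAt⇒flipVia _ _ K

  same-positions : ∀ {a b c d e f g h e' f' g' h'} →
    FlipAt a b e f → FlipAt b c g h → FlipAt a d e' f' → FlipAt d c g' h' → g ≢ f → h ≢ e →
    ((e ≡ e' × g ≡ g') ⊎ (e ≡ g' × g ≡ e')) × ((f ≡ f' × h ≡ h') ⊎ (f ≡ h' × h ≡ f'))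
  same-positions {b = b} F G F' G' g≢f h≢e =
    matched (lost-in-two-flips F' G' (removed-before F) (stays-out G (removed-after F) (h≢e ∘ sym)))
            (lost-in-two-flips F' G' (stays-in (flipAt-sym F) (removed-before G) g≢f) (removed-after G))
            (λ e≡g → apart b (removed-before G) (removed-after F) (sym e≡g)) ,
    matched (gained-in-two-flips F' G' (added-before F) (stays-in G (added-after F) (g≢f ∘ sym)))
            (gained-in-two-flips F' G' (stays-out (flipAt-sym F) (added-before G) h≢e) (added-after G))
            (apart b (added-after F) (added-before G))

  -- Of the two ways of matching positions, a wrong one
  -- would make b = d, contradict uniqueness of flips, or put two crossing
  -- diagonals in d.
  square-at : ∀ {a b c d e f g h e' f' g' h'} →
    IsTriangulation n a → IsSimplex n b → IsSimplex n c → IsSimplex n d → a ≢ c → b ≢ d →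
    FlipAt a b e f → FlipAt b c g h → FlipAt a d e' f' → FlipAt d c g' h' → GeodesicSquare a b c d
  square-at {a} {b} {c} {d} {e} {f} {g} {h} ta sb sc sd a≢c b≢d F G F' G'
    with second-flip-independent ta sb sc F G a≢c
  ... | g≢f , h≢e with same-positions F G F' G' g≢f h≢e
  ...   | inj₁ (refl , _) , inj₁ (refl , _) = ⊥-elim (b≢d (flip-determined F F'))
  ...   | inj₁ (refl , _) , inj₂ (_ , refl) =
    ⊥-elim (apart b (added-after F) (added-before G)
      (replacement-unique {x = a} e f h ta (removed-before F)
                          (flip-candidate F sb) (flip-candidate F' sd)))
  ...   | inj₂ (_ , refl) , inj₁ (refl , _) =
    ⊥-elim (simplex-no-cross {y = d} sd
      (stays-in F' (removed-before F) (λ e≡g → apart b (removed-before G) (removed-after F) (sym e≡g)))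
      (added-after F') (flip-crosses ta sb F))
  ...   | inj₂ (refl , refl) , inj₂ (refl , refl) =
    geodesic-square e f g h F G (flipAt-sym G') (flipAt-sym F')

  square : ∀ {a b c d} → IsTriangulation n a → IsTriangulation n b → IsTriangulation n c →
    IsTriangulation n d → a ≢ c → b ≢ d →
    Flip a b → Flip b c → Flip a d → Flip d c → GeodesicSquare a b c d
  square {a} {b} {c} {d} ta tb tc td a≢c b≢d Fab Fbc Fad Fdc
    with flip⇒flipAt {a} {b} Fab | flip⇒flipAt {b} {c} Fbc
       | flip⇒flipAt {a} {d} Fad | flip⇒flipAt {d} {c} Fdc
  ... | _ , _ , F | _ , _ , G | _ , _ , F' | _ , _ , G' =
    square-at ta (proj₁ tb) (proj₁ tc) (proj₁ td) a≢c b≢d F G F' G'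

_≟D_ : ∀ {n} (a b : DiagSet n) → Dec (a ≡ b)
_≟D_ = VecP.≡-dec (VecP.≡-dec BoolP._≟_)

near-sym : ∀ {n} {a b : DiagSet n} → Near a b → Near b a
near-sym (inj₁ a≡b) = inj₁ (sym a≡b)
near-sym {n} {a} {b} (inj₂ F) with flip⇒flipAt {n} {a} {b} F
... | p , q , G = inj₂ (proj₁ q , proj₂ q , proj₁ p , proj₂ p , flipAt⇒flipVia q p (flipAt-sym G))

near-flip : ∀ {n} {a b : DiagSet n} → Near a b → a ≢ b → Flip a b
near-flip (inj₁ a≡b) a≢b = ⊥-elim (a≢b a≡b)
near-flip (inj₂ F) _ = F

near-through : ∀ {n} {a b c : DiagSet n} → Near a b → Near b c → b ≡ a ⊎ b ≡ c → Near a c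
near-through _ b~c (inj₁ refl) = b~c
near-through a~b _ (inj₂ refl) = a~b

module _ {A : Set} where

  last-snoc : ∀ (x : A) xs y → last (x ∷ (xs ∷ʳ y)) ≡ just y
  last-snoc x [] y = refl
  last-snoc x (z ∷ zs) y = last-snoc z zs y

  last-++ : ∀ (xs : List A) y ys → last (xs ++ y ∷ ys) ≡ last (y ∷ ys)
  last-++ [] y ys = refl
  last-++ (x ∷ []) y ys = refl
  last-++ (x ∷ x' ∷ xs) y ys = last-++ (x' ∷ xs) y ys

  head-++ : ∀ (xs : List A) y ys zs → head (xs ++ y ∷ ys) ≡ head (xs ++ y ∷ zs)
  head-++ [] y ys zs = refl
  head-++ (x ∷ xs) y ys zs = refl

  module _ {R : A → A → Set} where

    linked-split : ∀ xs y ys → Linked R (xs ++ y ∷ ys) →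
                   Linked R (xs ++ y ∷ []) × Linked R (y ∷ ys)
    linked-split [] y ys chain = [-] , chain
    linked-split (x ∷ []) y ys (r ∷ chain) = r ∷ [-] , chain
    linked-split (x ∷ x' ∷ xs) y ys (r ∷ chain) =
      Product.map₁ (r ∷_) (linked-split (x' ∷ xs) y ys chain)

    linked-join : ∀ xs y ys → Linked R (xs ++ y ∷ []) → Linked R (y ∷ ys) →
                  Linked R (xs ++ y ∷ ys)
    linked-join [] y ys _ chain = chain
    linked-join (x ∷ []) y ys (r ∷ [-]) chain = r ∷ chain
    linked-join (x ∷ x' ∷ xs) y ys (r ∷ front) chain = r ∷ linked-join (x' ∷ xs) y ys front chain

module Loops (n : ℕ) (T₀ : DiagSet n) where

  Loop : List (DiagSet n) → Set
  Loop = IsLoop n T₀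

  Ops : List (DiagSet n) → List (DiagSet n) → Set
  Ops = TransformableByOps n T₀

  Anchored : List (DiagSet n) → Set
  Anchored L = head L ≡ just T₀ × last L ≡ just T₀

  anchored : ∀ {L} → Loop L → Anchored L
  anchored (_ , _ , inj₁ refl) = refl , refl
  anchored (_ , _ , inj₂ (mid , refl)) = refl , last-snoc T₀ mid T₀

  anchored⇒shape : ∀ L → Anchored L → (L ≡ T₀ ∷ []) ⊎ (∃[ mid ] (L ≡ T₀ ∷ (mid ∷ʳ T₀)))
  anchored⇒shape [] (() , _)
  anchored⇒shape (x ∷ xs) (hd , lt) with just-injective hd
  ... | refl with initLast xs
  ...   | [] = inj₁ refl
  ...   | ys ∷ʳ′ z with just-injective (trans (sym (last-snoc T₀ ys z)) lt)
  ...     | refl = inj₂ (ys , refl)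

  no-empty-loop : ¬ Loop []
  no-empty-loop L with proj₁ (anchored L)
  ... | ()

  first-term : ∀ {x X} → Loop (x ∷ X) → x ≡ T₀
  first-term L = just-injective (proj₁ (anchored L))

  last-term : ∀ P x → Loop (P ++ x ∷ []) → x ≡ T₀
  last-term P x L = just-injective (trans (sym (last-++ P x [])) (proj₂ (anchored L)))

  reanchor : ∀ P t X Y → Anchored (P ++ t ∷ X) → last (t ∷ Y) ≡ just T₀ → Anchored (P ++ t ∷ Y)
  reanchor P t X Y (hd , _) lt = trans (head-++ P t Y X) hd , trans (last-++ P t Y) lt

  glue-at : ∀ P t X Q S → Loop (P ++ t ∷ X) → Loop (Q ++ t ∷ S) → Loop (P ++ t ∷ S)
  glue-at P t X Q S L₁@(tri₁ , chain₁ , _) L₂@(tri₂ , chain₂ , _) =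
    ++⁺ (++⁻ˡ P tri₁) (++⁻ʳ Q tri₂) ,
    linked-join P t S (proj₁ (linked-split P t X chain₁)) (proj₂ (linked-split Q t S chain₂)) ,
    anchored⇒shape _ (reanchor P t X S (anchored L₁)
                        (trans (sym (last-++ Q t S)) (proj₂ (anchored L₂))))

  glue-near : ∀ P t X Q s S → Loop (P ++ t ∷ X) → Loop (Q ++ s ∷ S) → Near t s →
              Loop (P ++ t ∷ s ∷ S)
  glue-near P t X Q s S L₁@(tri₁ , chain₁ , _) L₂@(tri₂ , chain₂ , _) t~s =
    ++⁺ (++⁻ˡ P tri₁) (All.head (++⁻ʳ P tri₁) ∷ ++⁻ʳ Q tri₂) ,
    linked-join P t (s ∷ S) (proj₁ (linked-split P t X chain₁))
                (t~s ∷ proj₂ (linked-split Q s S chain₂)) ,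
    anchored⇒shape _ (reanchor P t X (s ∷ S) (anchored L₁)
                        (trans (sym (last-++ Q s S)) (proj₂ (anchored L₂))))

  regroup : ∀ P ys zs → Loop (P ++ ys ++ zs) → Loop ((P ++ ys) ++ zs)
  regroup P ys zs = subst Loop (sym (++-assoc P ys zs))

  skip : ∀ pre a b c post → Loop (pre ++ a ∷ b ∷ c ∷ post) → Near a c → Loop (pre ++ a ∷ c ∷ post)
  skip pre a b c post L a~c =
    glue-near pre a _ (pre ++ a ∷ b ∷ []) c post L (regroup pre (a ∷ b ∷ []) (c ∷ post) L) a~c

  cut : ∀ pre a b post → Loop (pre ++ a ∷ b ∷ a ∷ post) → Loop (pre ++ a ∷ post)
  cut pre a b post L =
    glue-at pre a _ (pre ++ a ∷ b ∷ []) post L (regroup pre (a ∷ b ∷ []) (a ∷ post) L)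

  record Window (a b c : DiagSet n) : Set where
    field
      tri-a : IsTriangulation n a
      tri-b : IsTriangulation n b
      tri-c : IsTriangulation n c
      a~b   : Near a b
      b~c   : Near b c
  open Window

  window : ∀ pre a b c post → Loop (pre ++ a ∷ b ∷ c ∷ post) → Window a b c
  window pre a b c post (tris , chain , _) = record
    { tri-a = All.head terms
    ; tri-b = All.head (All.tail terms)
    ; tri-c = All.head (All.tail (All.tail terms))
    ; a~b   = Linked.head links
    ; b~c   = Linked.head (Linked.tail links)
    }
    where
      terms : All.All (IsTriangulation n) (a ∷ b ∷ c ∷ post)
      terms = ++⁻ʳ pre tris
      links : Linked Near (a ∷ b ∷ c ∷ post)
      links = proj₂ (linked-split pre a (b ∷ c ∷ post) chain)

  op : ∀ {σ τ} → OpStep n T₀ σ τ → Ops σ τ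
  op step = fwd step ◅ ε

  op⁻¹ : ∀ {σ τ} → OpStep n T₀ τ σ → Ops σ τ
  op⁻¹ step = bwd step ◅ ε

  destretch : ∀ {σ σ'} pre x post → σ ≡ pre ++ x ∷ post → σ' ≡ pre ++ x ∷ x ∷ post →
              Loop σ → Loop σ' → Ops σ' σ
  destretch pre x post σ≡ σ'≡ L L' = op⁻¹ (L , L' , inj₁ (pre , x , post , σ≡ , σ'≡))

  -- A detour a , b , a to a near triangulation is undone by a de-insertion (or
  -- a de-stretch if b = a) followed by a de-stretch.
  remove-detour : ∀ pre a b post → Near a b → Loop (pre ++ a ∷ b ∷ a ∷ post) →
                  Ops (pre ++ a ∷ b ∷ a ∷ post) (pre ++ a ∷ post)
  remove-detour pre a b post (inj₁ refl) L =
    destretch pre a (a ∷ post) refl refl L₂ L ◅◅ destretch pre a post refl refl (cut pre a a post L) L₂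
    where
      L₂ : Loop (pre ++ a ∷ a ∷ post)
      L₂ = skip pre a a a post L (inj₁ refl)
  remove-detour pre a b post (inj₂ a↝b) L =
    op⁻¹ (L₂ , L , inj₂ (inj₁ (pre , a , b , post , refl , refl , a↝b)))
    ◅◅ destretch pre a post refl refl (cut pre a b post L) L₂
    where
      L₂ : Loop (pre ++ a ∷ a ∷ post)
      L₂ = skip pre a b a post L (inj₁ refl)

  -- If a ≠ c are near, a middle term d near both is a or c (Γ is
  -- triangle-free), so it is removed by a de-stretch.
  shortcut : ∀ pre a d c post → a ≢ c → Near a c → Window a d c →
             Loop (pre ++ a ∷ d ∷ c ∷ post) → Ops (pre ++ a ∷ d ∷ c ∷ post) (pre ++ a ∷ c ∷ post)
  shortcut pre a d c post a≢c a~c W L with d ≟D a | d ≟D c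
  ... | yes refl | _ = destretch pre d (c ∷ post) refl refl (skip pre d d c post L a~c) L
  ... | no _ | yes refl =
    destretch (pre ++ a ∷ []) d post (sym (++-assoc pre (a ∷ []) (d ∷ post)))
              (sym (++-assoc pre (a ∷ []) (d ∷ d ∷ post))) (skip pre a d d post L a~c) L
  ... | no d≢a | no d≢c =
    ⊥-elim (triangle-free {n} {a} {d} {c} (tri-a W) (tri-b W) (tri-c W)
             (near-flip (a~b W) (d≢a ∘ sym)) (near-flip (b~c W) d≢c) (near-flip a~c a≢c))

  via-chord : ∀ pre a b c d post → a ≢ c → Near a c →
    Loop (pre ++ a ∷ b ∷ c ∷ post) → Loop (pre ++ a ∷ d ∷ c ∷ post) → Window a b c → Window a d c →
    Ops (pre ++ a ∷ b ∷ c ∷ post) (pre ++ a ∷ d ∷ c ∷ post)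
  via-chord pre a b c d post a≢c a~c L₁ L₂ W₁ W₂ =
    shortcut pre a b c post a≢c a~c W₁ L₁
    ◅◅ EqC.symmetric (OpStep n T₀) (shortcut pre a d c post a≢c a~c W₂ L₂)

  switch : ∀ pre a b c d post → Window a b c → Window a d c → a ≢ c → b ≢ d →
    ¬ (b ≡ a ⊎ b ≡ c) → ¬ (d ≡ a ⊎ d ≡ c) →
    Switch (pre ++ a ∷ b ∷ c ∷ post) (pre ++ a ∷ d ∷ c ∷ post)
  switch pre a b c d post W₁ W₂ a≢c b≢d b∉ac d∉ac =
    pre , a , b , c , d , post , refl , refl ,
    a≢b , a≢c , a≢d , b≢c , b≢d , d≢c ∘ sym ,
    square {n} {a} {b} {c} {d} (tri-a W₁) (tri-b W₁) (tri-c W₁) (tri-b W₂) a≢c b≢d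
      (near-flip (a~b W₁) a≢b) (near-flip (b~c W₁) b≢c)
      (near-flip (a~b W₂) a≢d) (near-flip (b~c W₂) d≢c)
    where
      a≢b : a ≢ b
      a≢b = b∉ac ∘ inj₁ ∘ sym
      b≢c : b ≢ c
      b≢c = b∉ac ∘ inj₂
      a≢d : a ≢ d
      a≢d = d∉ac ∘ inj₁ ∘ sym
      d≢c : d ≢ c
      d≢c = d∉ac ∘ inj₂

  -- Replacing the middle term of a , b , c by d, where a , b , c , d is a
  -- closed walk of length 4 in Γ (repetitions allowed), is a composite of
  -- operations.
  fill-square : ∀ pre a b c d post →
    Loop (pre ++ a ∷ b ∷ c ∷ post) → Loop (pre ++ a ∷ d ∷ c ∷ post) → Window a b c → Window a d c →
    Ops (pre ++ a ∷ b ∷ c ∷ post) (pre ++ a ∷ d ∷ c ∷ post)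
  fill-square pre a b c d post L₁ L₂ W₁ W₂ with a ≟D c
  ... | yes refl =
    remove-detour pre a b post (a~b W₁) L₁
    ◅◅ EqC.symmetric (OpStep n T₀) (remove-detour pre a d post (a~b W₂) L₂)
  ... | no a≢c with (b ≟D a) ⊎-dec (b ≟D c) | (d ≟D a) ⊎-dec (d ≟D c)
  ...   | yes b∈ac | _ =
    via-chord pre a b c d post a≢c (near-through (a~b W₁) (b~c W₁) b∈ac) L₁ L₂ W₁ W₂
  ...   | no _ | yes d∈ac =
    via-chord pre a b c d post a≢c (near-through (a~b W₂) (b~c W₂) d∈ac) L₁ L₂ W₁ W₂
  ...   | no b∉ac | no d∉ac with b ≟D d
  ...     | yes refl = ε
  ...     | no b≢d =
    op (L₁ , L₂ , inj₂ (inj₂ (switch pre a b c d post W₁ W₂ a≢c b≢d b∉ac d∉ac)))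

  -- The current loop is
  -- P ++ t ∷ s ∷ S where P ++ t ∷ R is τ, Q ++ s ∷ S is σ and S , R are
  -- pointwise near; replacing s by the next term of τ advances one column.
  sweep : ∀ P t {R} Q s {S} → Loop (P ++ t ∷ R) → Loop (Q ++ s ∷ S) →
          Pointwise Near S R → Near s t → Ops (P ++ t ∷ s ∷ S) (P ++ t ∷ R)
  sweep P t Q s Lτ Lσ [] s~t =
    destretch P t [] refl (cong (λ z → P ++ t ∷ z ∷ []) s≡t) Lτ
              (glue-near P t [] Q s [] Lτ Lσ (near-sym s~t))
    where
      s≡t : s ≡ t
      s≡t = trans (last-term Q s Lσ) (sym (last-term P t Lτ))
  sweep P t {t' ∷ R} Q s {s' ∷ S} Lτ Lσ (s'~t' ∷ rest) s~t =
    fill-square P t s s' t' S L₁ L₂ (window P t s s' S L₁) (window P t t' s' S L₂)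
    ◅◅ subst₂ Ops (++-assoc P (t ∷ []) (t' ∷ s' ∷ S)) (++-assoc P (t ∷ []) (t' ∷ R))
         (sweep (P ++ t ∷ []) t' (Q ++ s ∷ []) s' Lτ' Lσ' rest s'~t')
    where
      Lτ' : Loop ((P ++ t ∷ []) ++ t' ∷ R)
      Lτ' = regroup P (t ∷ []) (t' ∷ R) Lτ
      Lσ' : Loop ((Q ++ s ∷ []) ++ s' ∷ S)
      Lσ' = regroup Q (s ∷ []) (s' ∷ S) Lσ
      L₁ : Loop (P ++ t ∷ s ∷ s' ∷ S)
      L₁ = glue-near P t _ Q s (s' ∷ S) Lτ Lσ (near-sym s~t)
      L₂ : Loop (P ++ t ∷ t' ∷ s' ∷ S)
      L₂ = subst Loop (++-assoc P (t ∷ []) (t' ∷ s' ∷ S))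
             (glue-near (P ++ t ∷ []) t' R (Q ++ s ∷ []) s' S Lτ' Lσ' (near-sym s'~t'))

  -- A grid step is a composite of operations: stretch the base point, then sweep.
  grid : ∀ {σ τ} → Loop σ → Loop τ → Pointwise Near σ τ → Ops σ τ
  grid Lσ Lτ [] = ⊥-elim (no-empty-loop Lσ)
  grid {x ∷ xs} {y ∷ ys} Lσ Lτ (x~y ∷ rest) =
    op (Lσ , L₀ , inj₁ ([] , x , xs , refl , cong (_∷ x ∷ xs) y≡x))
    ◅◅ sweep [] y [] x Lτ Lσ rest x~y
    where
      y≡x : y ≡ x
      y≡x = trans (first-term Lτ) (sym (first-term Lσ))
      L₀ : Loop (y ∷ x ∷ xs)
      L₀ = glue-near [] y ys [] x xs Lτ Lσ (near-sym x~y)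

  homotopy-step : ∀ {σ τ} → HomStep n T₀ σ τ → Ops σ τ
  homotopy-step (Lσ , Lτ , inj₁ stretch) = op (Lσ , Lτ , inj₁ stretch)
  homotopy-step (Lσ , Lτ , inj₂ gridStep) = grid Lσ Lτ gridStep

proposition3p5 : (n : ℕ) (T₀ : DiagSet n) (σ τ : List (DiagSet n)) →
    IsTriangulation n T₀ → IsLoop n T₀ σ → IsLoop n T₀ τ →
    HomotopicA n T₀ σ τ → TransformableByOps n T₀ σ τ
proposition3p5 n T₀ σ τ _ _ _ =
  EqC.fold (EqC.isEquivalence (OpStep n T₀)) (Loops.homotopy-step n T₀)
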